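{- Let $p,q\in[0,1]$ and $\varepsilon>0$. Given unconditional sampling access to $\mathrm{Ber}(p)$ and $\mathrm{Ber}(q)$, there is an algorithm that takes $O(1/\varepsilon)$ samples from each of them and, with probability at least $2/3$, accepts if $p=q$ and rejects if $\chi^2(p,q)>\varepsilon$.
   Context: $\mathrm{Ber}(p)$ is the distribution over $\{0,1\}$ that outputs $1$ with probability $p$. For $p,q\in[0,1]$, $\chi^2(p,q)=\frac{(p-q)^2}{(p+q)(2-(p+q))}$ (taken to be $0$ when $p=q$).
   Formalization: The probabilities p, q and the parameter ε range over the rationals, and the algorithm's acceptance probability on each pair of sample sequences takes values in ℚ. -}

module Defs where

open import Data.Bool using (Bool; true; false)
open import Data.Nat using (ℕ; zero; suc)
open import Data.Integer using (+_)
open import Data.List using (List; []; _∷_; map; concatMap)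
open import Data.Vec using (Vec; []; _∷_)
open import Data.Rational using (ℚ; 0ℚ; 1ℚ; _+_; _*_; _-_; _÷_; _/_; _≤_; _<_; ≢-nonZero)
open import Data.Rational.Properties using (_≟_)
open import Relation.Nullary using (yes; no)

InUnit : ℚ → Set
InUnit p = (0ℚ ≤ p) Data.Product.× (p ≤ 1ℚ)
  where import Data.Product

-- chi^2(p,q) = (p-q)^2 / ((p+q)(2-(p+q))), taken to be 0 when the
-- denominator vanishes (for p,q ∈ [0,1] this happens iff p = q = 0 or
-- p = q = 1, where the convention χ²(p,p)=0 applies).
chi2 : ℚ → ℚ → ℚ
chi2 p q with ((p + q) * ((1ℚ + 1ℚ) - (p + q))) ≟ 0ℚ
... | yes _  = 0ℚ
... | no den≢0 = ((p - q) * (p - q)) ÷ ((p + q) * ((1ℚ + 1ℚ) - (p + q)))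
  where instance _ = ≢-nonZero den≢0

allVecs : (m : ℕ) → List (Vec Bool m)
allVecs zero    = [] ∷ []
allVecs (suc m) = concatMap (λ v → (false ∷ v) ∷ (true ∷ v) ∷ []) (allVecs m)

seqProb : ∀ {m} → ℚ → Vec Bool m → ℚ
seqProb p []          = 1ℚ
seqProb p (true ∷ v)  = p * seqProb p v
seqProb p (false ∷ v) = (1ℚ - p) * seqProb p v

sumℚ : List ℚ → ℚ
sumℚ []       = 0ℚ
sumℚ (x ∷ xs) = x + sumℚ xs

-- A (possibly randomized) tester using m samples from each distribution:
-- A xs ys is the probability that it ACCEPTS on samples xs ~ Ber(p)^m,
-- ys ~ Ber(q)^m.
Tester : ℕ → Set
Tester m = Vec Bool m → Vec Bool m → ℚ

ValidTester : ∀ {m} → Tester m → Set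
ValidTester {m} A = ∀ (xs ys : Vec Bool m) → InUnit (A xs ys)

accProb : ∀ {m} → Tester m → ℚ → ℚ → ℚ
accProb {m} A p q =
  sumℚ (concatMap (λ xs → map (λ ys → seqProb p xs * seqProb q ys * A xs ys) (allVecs m)) (allVecs m))

twoThirds : ℚ
twoThirds = + 2 / 3

oneThird : ℚ
oneThird = + 1 / 3

-- Split 3n sample pairs (xᵢ, yᵢ) into three blocks of n, with 16 ≤ nε ≤ 17.  On each of
-- the first two blocks let T be the sum of the differences xᵢ − yᵢ, on the third let N count
-- the mismatches xᵢ ≠ yᵢ, and accept iff R = T₁T₂ − 3N − 5 ≤ 0.  With d = p − q and
-- r = p(1 − q) + q(1 − p), independence of the blocks gives E R = (nd)² − 3nr − 5 and
-- Var R = (n(r − d²) + (nd)²)² − (nd)⁴ + 9n(r − r²).  If p = q then E R < 0.  If χ²(p,q) > ε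
-- then ε(2r − d²) < d², as 2r − d² is the denominator of χ²; this forces nr ≥ 16 and
-- (nd)² ≥ 16nr, so E R > 0.  In both cases 3 Var R ≤ (E R)², and Chebyshev's inequality
-- bounds the error probability by 1/3.  For ε ≥ 1 there is nothing to reject, as χ² ≤ 1.

{-# OPTIONS --safe #-}
module Submission where

open import Defs
open import Data.Bool using (Bool; true; false)
open import Data.Empty using (⊥-elim)
open import Data.Integer as ℤ using (+_; +[1+_]; -[1+_])
import Data.Integer.Properties as ℤ
open import Data.List using (List; []; _∷_; map; concatMap; _++_)
open import Data.Nat as ℕ using (ℕ; zero; suc)
import Data.Nat.Properties as ℕ
open import Data.Product using (Σ; _×_; _,_; proj₁; proj₂; ∃-syntax; uncurry)
open import Data.Sum using (inj₁; inj₂; [_,_]′)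
open import Data.Rational
  using (ℚ; mkℚ; 0ℚ; 1ℚ; _+_; _*_; _-_; -_; _/_; _÷_; 1/_; _≤_; _<_; toℚᵘ; ≢-nonZero; positive; nonNegative)
import Data.Rational as ℚ
open import Data.Rational.Properties
import Data.Rational.Unnormalised as ℚᵘ
import Data.Rational.Unnormalised.Properties as ℚᵘ
open import Data.Rational.Solver using (module +-*-Solver)
open import Data.Vec using (Vec; []; _∷_; [_]; head; take; drop)
open import Relation.Binary.PropositionalEquality hiding ([_])
open import Relation.Binary.Definitions using (tri<; tri≈; tri>)
open import Relation.Nullary using (yes; no)

open +-*-Solver

p≤q⇒0≤q-p : ∀ {p q} → p ≤ q → 0ℚ ≤ q - p
p≤q⇒0≤q-p {p} {q} p≤q = begin
  0ℚ    ≡⟨ +-inverseʳ p ⟨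
  p - p ≤⟨ +-monoˡ-≤ (- p) p≤q ⟩
  q - p ∎
  where open ≤-Reasoning

≤-by-nonNeg-gap : ∀ {p q} r → 0ℚ ≤ r → q ≡ p + r → p ≤ q
≤-by-nonNeg-gap {p} {q} r 0≤r q≡p+r = begin
  p      ≡⟨ +-identityʳ p ⟨
  p + 0ℚ ≤⟨ +-monoʳ-≤ p 0≤r ⟩
  p + r  ≡⟨ q≡p+r ⟨
  q      ∎
  where open ≤-Reasoning

p-q≤p : ∀ {p q} → 0ℚ ≤ q → p - q ≤ p
p-q≤p {p} {q} 0≤q = ≤-by-nonNeg-gap q 0≤q (solve 2 (λ p q → p := p :- q :+ q) refl p q)

*-nonNeg : ∀ {p q} → 0ℚ ≤ p → 0ℚ ≤ q → 0ℚ ≤ p * q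
*-nonNeg {p} {q} 0≤p 0≤q = nonNegative⁻¹ (p * q)
  {{nonNeg*nonNeg⇒nonNeg p {{nonNegative 0≤p}} q {{nonNegative 0≤q}}}}

*-pos : ∀ {p q} → 0ℚ < p → 0ℚ < q → 0ℚ < p * q
*-pos {p} {q} 0<p 0<q = positive⁻¹ (p * q) {{pos*pos⇒pos p {{positive 0<p}} q {{positive 0<q}}}}

*-monoˡ-≤-≥0 : ∀ {r p q} → 0ℚ ≤ r → p ≤ q → r * p ≤ r * q
*-monoˡ-≤-≥0 {r} 0≤r = *-monoˡ-≤-nonNeg r {{nonNegative 0≤r}}

*-mono-≤-≥0 : ∀ {p q r s} → 0ℚ ≤ p → 0ℚ ≤ r → p ≤ q → r ≤ s → p * r ≤ q * s
*-mono-≤-≥0 {p} {q} {r} {s} 0≤p 0≤r p≤q r≤s = begin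
  p * r ≤⟨ *-monoˡ-≤-≥0 0≤p r≤s ⟩
  p * s ≤⟨ *-monoʳ-≤-nonNeg s {{nonNegative (≤-trans 0≤r r≤s)}} p≤q ⟩
  q * s ∎
  where open ≤-Reasoning

square-nonNeg : ∀ p → 0ℚ ≤ p * p
square-nonNeg p with ≤-total 0ℚ p
... | inj₁ 0≤p = *-nonNeg 0≤p 0≤p
... | inj₂ p≤0 = subst (0ℚ ≤_) (solve 1 (λ p → (:- p) :* (:- p) := p :* p) refl p)
                   (*-nonNeg (neg-antimono-≤ p≤0) (neg-antimono-≤ p≤0))

square-mono-≤ : ∀ {p q} → 0ℚ ≤ p → p ≤ q → p * p ≤ q * q
square-mono-≤ 0≤p p≤q = *-mono-≤-≥0 0≤p 0≤p p≤q p≤q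

sumℚ-++ : ∀ xs ys → sumℚ (xs ++ ys) ≡ sumℚ xs + sumℚ ys
sumℚ-++ []       ys = sym (+-identityˡ (sumℚ ys))
sumℚ-++ (x ∷ xs) ys = trans (cong (λ s → x + s) (sumℚ-++ xs ys)) (sym (+-assoc x (sumℚ xs) (sumℚ ys)))

module _ {A : Set} where

  sumℚ-map-cong : ∀ {f g : A → ℚ} xs → (∀ v → f v ≡ g v) → sumℚ (map f xs) ≡ sumℚ (map g xs)
  sumℚ-map-cong []       f≗g = refl
  sumℚ-map-cong (x ∷ xs) f≗g = cong₂ _+_ (f≗g x) (sumℚ-map-cong xs f≗g)

  sumℚ-map-mono : ∀ {f g : A → ℚ} xs → (∀ v → f v ≤ g v) → sumℚ (map f xs) ≤ sumℚ (map g xs)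
  sumℚ-map-mono []       f≤g = ≤-refl
  sumℚ-map-mono (x ∷ xs) f≤g = +-mono-≤ (f≤g x) (sumℚ-map-mono xs f≤g)

  sumℚ-map-+ : ∀ (f g : A → ℚ) xs →
               sumℚ (map (λ v → f v + g v) xs) ≡ sumℚ (map f xs) + sumℚ (map g xs)
  sumℚ-map-+ f g []       = sym (+-identityˡ 0ℚ)
  sumℚ-map-+ f g (x ∷ xs) = trans (cong (λ s → f x + g x + s) (sumℚ-map-+ f g xs))
    (solve 4 (λ a b c d → (a :+ b) :+ (c :+ d) := (a :+ c) :+ (b :+ d)) refl (f x) (g x) _ _)

  sumℚ-map-*ˡ : ∀ c (f : A → ℚ) xs → sumℚ (map (λ v → c * f v) xs) ≡ c * sumℚ (map f xs)
  sumℚ-map-*ˡ c f []       = sym (*-zeroʳ c)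
  sumℚ-map-*ˡ c f (x ∷ xs) =
    trans (cong (λ s → c * f x + s) (sumℚ-map-*ˡ c f xs)) (sym (*-distribˡ-+ c (f x) _))

𝔼 : ℚ → (m : ℕ) → (Vec Bool m → ℚ) → ℚ
𝔼 p m f = sumℚ (map (λ v → seqProb p v * f v) (allVecs m))

module _ (p : ℚ) where

  𝔼-zero : (f : Vec Bool 0 → ℚ) → 𝔼 p 0 f ≡ f []
  𝔼-zero f = solve 1 (λ a → con 1ℚ :* a :+ con 0ℚ := a) refl (f [])

  𝔼-suc : ∀ {m} (f : Vec Bool (suc m) → ℚ) →
          𝔼 p (suc m) f ≡ (1ℚ - p) * 𝔼 p m (λ v → f (false ∷ v)) + p * 𝔼 p m (λ v → f (true ∷ v))
  𝔼-suc {m} f = go (allVecs m)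
    where
    term : ∀ {k} → (Vec Bool k → ℚ) → Vec Bool k → ℚ
    term g v = seqProb p v * g v
    go : ∀ vs → sumℚ (map (term f) (concatMap (λ v → (false ∷ v) ∷ (true ∷ v) ∷ []) vs))
              ≡ (1ℚ - p) * sumℚ (map (term (λ v → f (false ∷ v))) vs)
                + p * sumℚ (map (term (λ v → f (true ∷ v))) vs)
    go []       = solve 1 (λ p → con 0ℚ := (con 1ℚ :- p) :* con 0ℚ :+ p :* con 0ℚ) refl p
    go (v ∷ vs) = trans (cong (λ s → (1ℚ - p) * seqProb p v * f (false ∷ v)
                                     + (p * seqProb p v * f (true ∷ v) + s)) (go vs))
      (solve 6 (λ p P a b X Y → (con 1ℚ :- p) :* P :* a :+ (p :* P :* b :+ ((con 1ℚ :- p) :* X :+ p :* Y))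
                  := (con 1ℚ :- p) :* (P :* a :+ X) :+ p :* (P :* b :+ Y))
             refl p (seqProb p v) (f (false ∷ v)) (f (true ∷ v)) _ _)

  𝔼-one : (f : Vec Bool 1 → ℚ) → 𝔼 p 1 f ≡ (1ℚ - p) * f [ false ] + p * f [ true ]
  𝔼-one f = trans (𝔼-suc f) (cong₂ (λ a b → (1ℚ - p) * a + p * b)
                                    (𝔼-zero (λ v → f (false ∷ v))) (𝔼-zero (λ v → f (true ∷ v))))

  𝔼-cong : ∀ {m} {f g : Vec Bool m → ℚ} → (∀ v → f v ≡ g v) → 𝔼 p m f ≡ 𝔼 p m g
  𝔼-cong {m} f≗g = sumℚ-map-cong (allVecs m) (λ v → cong (seqProb p v *_) (f≗g v))

  𝔼-+ : ∀ {m} (f g : Vec Bool m → ℚ) → 𝔼 p m (λ v → f v + g v) ≡ 𝔼 p m f + 𝔼 p m g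
  𝔼-+ {m} f g = trans (sumℚ-map-cong (allVecs m) (λ v → *-distribˡ-+ (seqProb p v) (f v) (g v)))
                      (sumℚ-map-+ _ _ (allVecs m))

  𝔼-*ˡ : ∀ {m} c (f : Vec Bool m → ℚ) → 𝔼 p m (λ v → c * f v) ≡ c * 𝔼 p m f
  𝔼-*ˡ {m} c f = trans (sumℚ-map-cong (allVecs m)
      (λ v → solve 3 (λ P c a → P :* (c :* a) := c :* (P :* a)) refl (seqProb p v) c (f v)))
    (sumℚ-map-*ˡ c _ (allVecs m))

  𝔼-const : ∀ m c → 𝔼 p m (λ _ → c) ≡ c
  𝔼-const zero    c = 𝔼-zero (λ _ → c)
  𝔼-const (suc m) c = begin
    𝔼 p (suc m) (λ _ → c)         ≡⟨ 𝔼-suc {m} (λ _ → c) ⟩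
    (1ℚ - p) * 𝔼 p m (λ _ → c) + p * 𝔼 p m (λ _ → c) ≡⟨ cong (λ e → (1ℚ - p) * e + p * e) (𝔼-const m c) ⟩
    (1ℚ - p) * c + p * c          ≡⟨ solve 2 (λ p c → (con 1ℚ :- p) :* c :+ p :* c := c) refl p c ⟩
    c                             ∎
    where open ≡-Reasoning

  𝔼-take*drop : ∀ a {b} (f : Vec Bool a → ℚ) (g : Vec Bool b → ℚ) →
                𝔼 p (a ℕ.+ b) (λ v → f (take a v) * g (drop a v)) ≡ 𝔼 p a f * 𝔼 p b g
  𝔼-take*drop zero    {b} f g = trans (𝔼-*ˡ (f []) g) (cong (_* 𝔼 p b g) (sym (𝔼-zero f)))
  𝔼-take*drop (suc a) {b} f g = begin
    𝔼 p (suc a ℕ.+ b) (λ v → f (take (suc a) v) * g (drop (suc a) v))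
      ≡⟨ 𝔼-suc {a ℕ.+ b} _ ⟩
    (1ℚ - p) * 𝔼 p (a ℕ.+ b) (λ v → f (false ∷ take a v) * g (drop a v))
      + p * 𝔼 p (a ℕ.+ b) (λ v → f (true ∷ take a v) * g (drop a v))
      ≡⟨ cong₂ (λ e₀ e₁ → (1ℚ - p) * e₀ + p * e₁) (𝔼-take*drop a (λ v → f (false ∷ v)) g)
                                                  (𝔼-take*drop a (λ v → f (true ∷ v)) g) ⟩
    (1ℚ - p) * (F₀ * G) + p * (F₁ * G)
      ≡⟨ solve 4 (λ p F₀ F₁ G → (con 1ℚ :- p) :* (F₀ :* G) :+ p :* (F₁ :* G)
                                := ((con 1ℚ :- p) :* F₀ :+ p :* F₁) :* G) refl p F₀ F₁ G ⟩
    ((1ℚ - p) * F₀ + p * F₁) * G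
      ≡⟨ cong (_* G) (𝔼-suc f) ⟨
    𝔼 p (suc a) f * G ∎
    where
    open ≡-Reasoning
    F₀ = 𝔼 p a (λ v → f (false ∷ v))
    F₁ = 𝔼 p a (λ v → f (true ∷ v))
    G  = 𝔼 p b g

  module _ (p∈[0,1] : InUnit p) where

    seqProb-nonNeg : ∀ {m} (v : Vec Bool m) → 0ℚ ≤ seqProb p v
    seqProb-nonNeg []          = ≤ᵇ⇒≤ {0ℚ} {1ℚ} _
    seqProb-nonNeg (true ∷ v)  = *-nonNeg (proj₁ p∈[0,1]) (seqProb-nonNeg v)
    seqProb-nonNeg (false ∷ v) = *-nonNeg (p≤q⇒0≤q-p (proj₂ p∈[0,1])) (seqProb-nonNeg v)

    𝔼-mono : ∀ {m} {f g : Vec Bool m → ℚ} → (∀ v → f v ≤ g v) → 𝔼 p m f ≤ 𝔼 p m g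
    𝔼-mono {m} f≤g = sumℚ-map-mono (allVecs m) (λ v → *-monoˡ-≤-≥0 (seqProb-nonNeg v) (f≤g v))

fromℕ : ℕ → ℚ
fromℕ n = + n / 1

fromℕ-nonNeg : ∀ n → 0ℚ ≤ fromℕ n
fromℕ-nonNeg n = nonNegative⁻¹ (fromℕ n) {{normalize-nonNeg n 1}}

fromℕ-+ : ∀ a b → fromℕ (a ℕ.+ b) ≡ fromℕ a + fromℕ b
fromℕ-+ a b = toℚᵘ-injective (begin
  toℚᵘ (fromℕ (a ℕ.+ b))                   ≈⟨ toℚᵘ-fromℚᵘ (ℚᵘ.mkℚᵘ (+ (a ℕ.+ b)) 0) ⟩
  ℚᵘ.mkℚᵘ (+ (a ℕ.+ b)) 0                  ≈⟨ ℚᵘ.*≡* integral ⟩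
  ℚᵘ.mkℚᵘ (+ a) 0 ℚᵘ.+ ℚᵘ.mkℚᵘ (+ b) 0     ≈⟨ ℚᵘ.+-cong (toℚᵘ-fromℚᵘ (ℚᵘ.mkℚᵘ (+ a) 0))
                                                          (toℚᵘ-fromℚᵘ (ℚᵘ.mkℚᵘ (+ b) 0)) ⟨
  toℚᵘ (fromℕ a) ℚᵘ.+ toℚᵘ (fromℕ b)       ≈⟨ toℚᵘ-homo-+ (fromℕ a) (fromℕ b) ⟨
  toℚᵘ (fromℕ a + fromℕ b)                 ∎)
  where
  open ℚᵘ.≃-Reasoning
  integral : + (a ℕ.+ b) ℤ.* + 1 ≡ (+ a ℤ.* + 1 ℤ.+ + b ℤ.* + 1) ℤ.* + 1
  integral = trans (ℤ.*-identityʳ _) (trans (ℤ.pos-+ a b) (sym (trans (ℤ.*-identityʳ _)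
               (cong₂ ℤ._+_ (ℤ.*-identityʳ (+ a)) (ℤ.*-identityʳ (+ b))))))

fromℕ-suc : ∀ n → fromℕ (suc n) ≡ 1ℚ + fromℕ n
fromℕ-suc = fromℕ-+ 1

fromℕ-* : ∀ a b → fromℕ (a ℕ.* b) ≡ fromℕ a * fromℕ b
fromℕ-* zero    b = sym (*-zeroˡ (fromℕ b))
fromℕ-* (suc a) b = begin
  fromℕ (b ℕ.+ a ℕ.* b)       ≡⟨ fromℕ-+ b (a ℕ.* b) ⟩
  fromℕ b + fromℕ (a ℕ.* b)   ≡⟨ cong (λ x → fromℕ b + x) (fromℕ-* a b) ⟩
  fromℕ b + fromℕ a * fromℕ b ≡⟨ solve 2 (λ a b → b :+ a :* b := (con 1ℚ :+ a) :* b) refl (fromℕ a) (fromℕ b) ⟩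
  (1ℚ + fromℕ a) * fromℕ b    ≡⟨ cong (_* fromℕ b) (fromℕ-suc a) ⟨
  fromℕ (suc a) * fromℕ b     ∎
  where open ≡-Reasoning

denominator*-≥1 : ∀ ε → 0ℚ < ε → 1ℚ ≤ fromℕ (ℚ.denominatorℕ ε) * ε
denominator*-≥1 (mkℚ (+ 0)     _ _) 0<ε = ⊥-elim (ℤ.Positive.pos (positive 0<ε))
denominator*-≥1 (mkℚ -[1+ _ ] _ _) 0<ε = ⊥-elim (ℤ.Positive.pos (positive 0<ε))
denominator*-≥1 (mkℚ +[1+ a ] b _) _ = toℚᵘ-cancel-≤ (begin
  toℚᵘ 1ℚ                                 ≤⟨ ℚᵘ.*≤* integral ⟩
  ℚᵘ.mkℚᵘ (+ suc b) 0 ℚᵘ.* ℚᵘ.mkℚᵘ +[1+ a ] b ≃⟨ ℚᵘ.*-congʳ (toℚᵘ-fromℚᵘ (ℚᵘ.mkℚᵘ (+ suc b) 0)) ⟨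
  toℚᵘ (fromℕ (suc b)) ℚᵘ.* toℚᵘ ε         ≃⟨ toℚᵘ-homo-* (fromℕ (suc b)) ε ⟨
  toℚᵘ (fromℕ (suc b) * ε)                ∎)
  where
  open ℚᵘ.≤-Reasoning
  ε = mkℚ +[1+ a ] b _
  integral : + 1 ℤ.* + (1 ℕ.* suc b) ℤ.≤ + (suc b ℕ.* suc a) ℤ.* + 1
  integral = subst₂ ℤ._≤_ (sym (trans (ℤ.*-identityˡ _) (cong +_ (ℕ.*-identityˡ (suc b)))))
                          (sym (ℤ.*-identityʳ _)) (ℤ.+≤+ (ℕ.m≤m*n (suc b) (suc a)))

multiple-between : ∀ {c ε} → 0ℚ < c → ∀ N → c ≤ fromℕ N * ε →
                   ∃[ n ] (c ≤ fromℕ n * ε × fromℕ n * ε ≤ c + ε)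
multiple-between {c} {ε} 0<c zero    c≤0 = ⊥-elim (<-irrefl refl (<-≤-trans 0<c (subst (c ≤_) (*-zeroˡ ε) c≤0)))
multiple-between {c} {ε} 0<c (suc N) c≤Nε with c ≤? fromℕ N * ε
... | yes c≤ = multiple-between 0<c N c≤
... | no  c≰ = suc N , c≤Nε , (begin
  fromℕ (suc N) * ε      ≡⟨ cong (_* ε) (fromℕ-suc N) ⟩
  (1ℚ + fromℕ N) * ε     ≡⟨ solve 2 (λ n ε → (con 1ℚ :+ n) :* ε := n :* ε :+ ε) refl (fromℕ N) ε ⟩
  fromℕ N * ε + ε        ≤⟨ +-monoˡ-≤ ε (<⇒≤ (≰⇒> c≰)) ⟩
  c + ε                  ∎)
  where open ≤-Reasoning

∃-multiple-between : ∀ k {ε} → 0ℚ < ε → ∃[ n ] (fromℕ (suc k) ≤ fromℕ n * ε × fromℕ n * ε ≤ fromℕ (suc k) + ε)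
∃-multiple-between k {ε} 0<ε = multiple-between (positive⁻¹ (fromℕ (suc k)) {{normalize-pos (suc k) 1}}) (suc k ℕ.* d) (begin
  fromℕ (suc k)                 ≡⟨ *-identityʳ (fromℕ (suc k)) ⟨
  fromℕ (suc k) * 1ℚ            ≤⟨ *-monoˡ-≤-≥0 (fromℕ-nonNeg (suc k)) (denominator*-≥1 ε 0<ε) ⟩
  fromℕ (suc k) * (fromℕ d * ε) ≡⟨ *-assoc (fromℕ (suc k)) (fromℕ d) ε ⟨
  fromℕ (suc k) * fromℕ d * ε   ≡⟨ cong (_* ε) (fromℕ-* (suc k) d) ⟨
  fromℕ (suc k ℕ.* d) * ε       ∎)
  where
  open ≤-Reasoning
  d = ℚ.denominatorℕ ε

Stat : ℕ → Set
Stat m = Vec Bool m → Vec Bool m → ℚ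

infixl 6 _⊕_
infixl 7 _⊗_

_⊕_ _⊗_ : ∀ {a b} → Stat a → Stat b → Stat (a ℕ.+ b)
_⊕_ {a} f g xs ys = f (take a xs) (take a ys) + g (drop a xs) (drop a ys)
_⊗_ {a} f g xs ys = f (take a xs) (take a ys) * g (drop a xs) (drop a ys)

square : ∀ {m} → Stat m → Stat m
square f xs ys = f xs ys * f xs ys

atHead : (Bool → Bool → ℚ) → Stat 1
atHead h xs ys = h (head xs) (head ys)

coordSum : (Bool → Bool → ℚ) → (k : ℕ) → Stat k
coordSum h zero    = λ _ _ → 0ℚ
coordSum h (suc k) = atHead h ⊕ coordSum h k

module Moments (p q : ℚ) where

  𝔼₂ : ∀ {m} → Stat m → ℚ
  𝔼₂ {m} f = 𝔼 p m (λ xs → 𝔼 q m (f xs))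

  Var : ∀ {m} → Stat m → ℚ
  Var f = 𝔼₂ (λ xs ys → (f xs ys - 𝔼₂ f) * (f xs ys - 𝔼₂ f))

  𝔼₂-cong : ∀ {m} {f g : Stat m} → (∀ xs ys → f xs ys ≡ g xs ys) → 𝔼₂ f ≡ 𝔼₂ g
  𝔼₂-cong {m} f≗g = 𝔼-cong p {m} (λ xs → 𝔼-cong q {m} (f≗g xs))

  𝔼₂-+ : ∀ {m} (f g : Stat m) → 𝔼₂ (λ xs ys → f xs ys + g xs ys) ≡ 𝔼₂ f + 𝔼₂ g
  𝔼₂-+ {m} f g = trans (𝔼-cong p {m} (λ xs → 𝔼-+ q (f xs) (g xs))) (𝔼-+ p (λ xs → 𝔼 q m (f xs)) (λ xs → 𝔼 q m (g xs)))

  𝔼₂-*ˡ : ∀ {m} c (f : Stat m) → 𝔼₂ (λ xs ys → c * f xs ys) ≡ c * 𝔼₂ f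
  𝔼₂-*ˡ {m} c f = trans (𝔼-cong p {m} (λ xs → 𝔼-*ˡ q c (f xs))) (𝔼-*ˡ p c (λ xs → 𝔼 q m (f xs)))

  𝔼₂-const : ∀ m c → 𝔼₂ {m} (λ _ _ → c) ≡ c
  𝔼₂-const m c = trans (𝔼-cong p {m} (λ _ → 𝔼-const q m c)) (𝔼-const p m c)

  𝔼₂-affine : ∀ {m} c k (f : Stat m) → 𝔼₂ (λ xs ys → c * f xs ys + k) ≡ c * 𝔼₂ f + k
  𝔼₂-affine {m} c k f = trans (𝔼₂-+ (λ xs ys → c * f xs ys) (λ _ _ → k))
                              (cong₂ _+_ (𝔼₂-*ˡ c f) (𝔼₂-const m k))

  𝔼₂-mono : InUnit p → InUnit q → ∀ {m} {f g : Stat m} →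
            (∀ xs ys → f xs ys ≤ g xs ys) → 𝔼₂ f ≤ 𝔼₂ g
  𝔼₂-mono p∈[0,1] q∈[0,1] f≤g = 𝔼-mono p p∈[0,1] (λ xs → 𝔼-mono q q∈[0,1] (f≤g xs))

  𝔼₂-atHead : ∀ h → 𝔼₂ (atHead h) ≡ (1ℚ - p) * ((1ℚ - q) * h false false + q * h false true)
                                    + p * ((1ℚ - q) * h true false + q * h true true)
  𝔼₂-atHead h = trans (𝔼-one p (λ xs → 𝔼 q 1 (atHead h xs)))
    (cong₂ (λ a b → (1ℚ - p) * a + p * b) (𝔼-one q (atHead h [ false ])) (𝔼-one q (atHead h [ true ])))

  𝔼₂-⊗ : ∀ {a b} (f : Stat a) (g : Stat b) → 𝔼₂ (f ⊗ g) ≡ 𝔼₂ f * 𝔼₂ g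
  𝔼₂-⊗ {a} {b} f g = trans (𝔼-cong p {a ℕ.+ b} (λ xs → 𝔼-take*drop q a (f (take a xs)) (g (drop a xs))))
                            (𝔼-take*drop p a _ _)

  𝔼₂-⊕ : ∀ {a b} (f : Stat a) (g : Stat b) → 𝔼₂ (f ⊕ g) ≡ 𝔼₂ f + 𝔼₂ g
  𝔼₂-⊕ {a} {b} f g = begin
    𝔼₂ (f ⊕ g)                       ≡⟨ 𝔼₂-cong ⊕-as-⊗ ⟩
    𝔼₂ (λ xs ys → (f ⊗ one b) xs ys + (one a ⊗ g) xs ys) ≡⟨ 𝔼₂-+ (f ⊗ one b) (one a ⊗ g) ⟩
    𝔼₂ (f ⊗ one b) + 𝔼₂ (one a ⊗ g)      ≡⟨ cong₂ _+_ (𝔼₂-⊗ f (one b)) (𝔼₂-⊗ (one a) g) ⟩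
    𝔼₂ f * 𝔼₂ (one b) + 𝔼₂ (one a) * 𝔼₂ g    ≡⟨ cong₂ (λ e₁ e₂ → 𝔼₂ f * e₁ + e₂ * 𝔼₂ g) (𝔼₂-const b 1ℚ) (𝔼₂-const a 1ℚ) ⟩
    𝔼₂ f * 1ℚ + 1ℚ * 𝔼₂ g            ≡⟨ cong₂ _+_ (*-identityʳ (𝔼₂ f)) (*-identityˡ (𝔼₂ g)) ⟩
    𝔼₂ f + 𝔼₂ g                      ∎
    where
    open ≡-Reasoning
    one : ∀ k → Stat k
    one _ _ _ = 1ℚ
    ⊕-as-⊗ : ∀ xs ys → (f ⊕ g) xs ys ≡ (f ⊗ one b) xs ys + (one a ⊗ g) xs ys
    ⊕-as-⊗ xs ys = sym (cong₂ _+_ (*-identityʳ (f (take a xs) (take a ys))) (*-identityˡ (g (drop a xs) (drop a ys))))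

  Var-moments : ∀ {m} (f : Stat m) → Var f ≡ 𝔼₂ (square f) - 𝔼₂ f * 𝔼₂ f
  Var-moments f = begin
    Var f                                        ≡⟨ 𝔼₂-cong (λ xs ys → expand (f xs ys)) ⟩
    𝔼₂ (λ xs ys → square f xs ys + (- (1ℚ + 1ℚ) * μ * f xs ys + μ * μ))
                                                 ≡⟨ 𝔼₂-+ (square f) _ ⟩
    𝔼₂ (square f) + 𝔼₂ (λ xs ys → - (1ℚ + 1ℚ) * μ * f xs ys + μ * μ)
                                                 ≡⟨ cong (λ e → 𝔼₂ (square f) + e) (𝔼₂-affine (- (1ℚ + 1ℚ) * μ) (μ * μ) f) ⟩
    𝔼₂ (square f) + (- (1ℚ + 1ℚ) * μ * μ + μ * μ) ≡⟨ solve 2 (λ s μ → s :+ (:- (con 1ℚ :+ con 1ℚ) :* μ :* μ :+ μ :* μ)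
                                                             := s :- μ :* μ) refl (𝔼₂ (square f)) μ ⟩
    𝔼₂ (square f) - μ * μ                        ∎
    where
    open ≡-Reasoning
    μ = 𝔼₂ f
    expand : ∀ a → (a - μ) * (a - μ) ≡ a * a + (- (1ℚ + 1ℚ) * μ * a + μ * μ)
    expand a = solve 2 (λ a μ → (a :- μ) :* (a :- μ) := a :* a :+ (:- (con 1ℚ :+ con 1ℚ) :* μ :* a :+ μ :* μ)) refl a μ

  𝔼₂-square : ∀ {m} (f : Stat m) → 𝔼₂ (square f) ≡ Var f + 𝔼₂ f * 𝔼₂ f
  𝔼₂-square f = begin
    𝔼₂ (square f)                             ≡⟨ solve 2 (λ s μ → s := s :- μ :* μ :+ μ :* μ) refl (𝔼₂ (square f)) (𝔼₂ f) ⟩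
    𝔼₂ (square f) - 𝔼₂ f * 𝔼₂ f + 𝔼₂ f * 𝔼₂ f ≡⟨ cong (_+ 𝔼₂ f * 𝔼₂ f) (Var-moments f) ⟨
    Var f + 𝔼₂ f * 𝔼₂ f                       ∎
    where open ≡-Reasoning

  Var-const : ∀ m c → Var {m} (λ _ _ → c) ≡ 0ℚ
  Var-const m c = begin
    Var {m} (λ _ _ → c)          ≡⟨ 𝔼₂-cong {m} (λ _ _ → cong (λ μ → (c - μ) * (c - μ)) (𝔼₂-const m c)) ⟩
    𝔼₂ {m} (λ _ _ → (c - c) * (c - c)) ≡⟨ 𝔼₂-const m ((c - c) * (c - c)) ⟩
    (c - c) * (c - c)            ≡⟨ solve 1 (λ c → (c :- c) :* (c :- c) := con 0ℚ) refl c ⟩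
    0ℚ                           ∎
    where open ≡-Reasoning

  Var-affine : ∀ {m} c k (f : Stat m) → Var (λ xs ys → c * f xs ys + k) ≡ c * c * Var f
  Var-affine c k f = begin
    Var (λ xs ys → c * f xs ys + k)                        ≡⟨ 𝔼₂-cong (λ xs ys → centred (f xs ys)) ⟩
    𝔼₂ (λ xs ys → c * c * ((f xs ys - μ) * (f xs ys - μ))) ≡⟨ 𝔼₂-*ˡ (c * c) (λ xs ys → (f xs ys - μ) * (f xs ys - μ)) ⟩
    c * c * Var f                                          ∎
    where
    open ≡-Reasoning
    μ = 𝔼₂ f
    centred : ∀ a → (c * a + k - 𝔼₂ (λ xs ys → c * f xs ys + k)) * (c * a + k - 𝔼₂ (λ xs ys → c * f xs ys + k))
                    ≡ c * c * ((a - μ) * (a - μ))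
    centred a = trans (cong (λ ν → (c * a + k - ν) * (c * a + k - ν)) (𝔼₂-affine c k f))
      (solve 4 (λ c k a μ → (c :* a :+ k :- (c :* μ :+ k)) :* (c :* a :+ k :- (c :* μ :+ k))
                            := c :* c :* ((a :- μ) :* (a :- μ))) refl c k a μ)

  Var-⊕ : ∀ {a b} (f : Stat a) (g : Stat b) → Var (f ⊕ g) ≡ Var f + Var g
  Var-⊕ {a} f g = begin
    Var (f ⊕ g)                                      ≡⟨ Var-moments (f ⊕ g) ⟩
    𝔼₂ (square (f ⊕ g)) - 𝔼₂ (f ⊕ g) * 𝔼₂ (f ⊕ g)  ≡⟨ cong₂ (λ s μ → s - μ * μ) second-moment (𝔼₂-⊕ f g) ⟩
    𝔼₂ (square f) + 𝔼₂ (square g) + (1ℚ + 1ℚ) * (𝔼₂ f * 𝔼₂ g) - (𝔼₂ f + 𝔼₂ g) * (𝔼₂ f + 𝔼₂ g)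
      ≡⟨ solve 4 (λ s t μ ν → s :+ t :+ (con 1ℚ :+ con 1ℚ) :* (μ :* ν) :- (μ :+ ν) :* (μ :+ ν)
                              := (s :- μ :* μ) :+ (t :- ν :* ν)) refl (𝔼₂ (square f)) (𝔼₂ (square g)) (𝔼₂ f) (𝔼₂ g) ⟩
    (𝔼₂ (square f) - 𝔼₂ f * 𝔼₂ f) + (𝔼₂ (square g) - 𝔼₂ g * 𝔼₂ g)
      ≡⟨ cong₂ _+_ (Var-moments f) (Var-moments g) ⟨
    Var f + Var g                                    ∎
    where
    open ≡-Reasoning
    expand : ∀ xs ys → square (f ⊕ g) xs ys ≡ (square f ⊕ square g) xs ys + (1ℚ + 1ℚ) * (f ⊗ g) xs ys
    expand xs ys = solve 2 (λ F G → (F :+ G) :* (F :+ G) := (F :* F :+ G :* G) :+ (con 1ℚ :+ con 1ℚ) :* (F :* G))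
                           refl (f (take a xs) (take a ys)) (g (drop a xs) (drop a ys))
    second-moment : 𝔼₂ (square (f ⊕ g)) ≡ 𝔼₂ (square f) + 𝔼₂ (square g) + (1ℚ + 1ℚ) * (𝔼₂ f * 𝔼₂ g)
    second-moment = begin
      𝔼₂ (square (f ⊕ g))
        ≡⟨ 𝔼₂-cong expand ⟩
      𝔼₂ (λ xs ys → (square f ⊕ square g) xs ys + (1ℚ + 1ℚ) * (f ⊗ g) xs ys)
        ≡⟨ 𝔼₂-+ (square f ⊕ square g) (λ xs ys → (1ℚ + 1ℚ) * (f ⊗ g) xs ys) ⟩
      𝔼₂ (square f ⊕ square g) + 𝔼₂ (λ xs ys → (1ℚ + 1ℚ) * (f ⊗ g) xs ys)
        ≡⟨ cong₂ _+_ (𝔼₂-⊕ (square f) (square g)) (trans (𝔼₂-*ˡ (1ℚ + 1ℚ) (f ⊗ g)) (cong ((1ℚ + 1ℚ) *_) (𝔼₂-⊗ f g))) ⟩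
      𝔼₂ (square f) + 𝔼₂ (square g) + (1ℚ + 1ℚ) * (𝔼₂ f * 𝔼₂ g) ∎

  Var-⊗ : ∀ {a b} (f : Stat a) (g : Stat b) →
          Var (f ⊗ g) ≡ 𝔼₂ (square f) * 𝔼₂ (square g) - (𝔼₂ f * 𝔼₂ g) * (𝔼₂ f * 𝔼₂ g)
  Var-⊗ {a} f g = begin
    Var (f ⊗ g)                                     ≡⟨ Var-moments (f ⊗ g) ⟩
    𝔼₂ (square (f ⊗ g)) - 𝔼₂ (f ⊗ g) * 𝔼₂ (f ⊗ g) ≡⟨ cong₂ (λ s μ → s - μ * μ) second-moment (𝔼₂-⊗ f g) ⟩
    𝔼₂ (square f) * 𝔼₂ (square g) - (𝔼₂ f * 𝔼₂ g) * (𝔼₂ f * 𝔼₂ g) ∎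
    where
    open ≡-Reasoning
    second-moment : 𝔼₂ (square (f ⊗ g)) ≡ 𝔼₂ (square f) * 𝔼₂ (square g)
    second-moment = trans (𝔼₂-cong (λ xs ys → solve 2 (λ F G → (F :* G) :* (F :* G) := (F :* F) :* (G :* G))
                                                  refl (f (take a xs) (take a ys)) (g (drop a xs) (drop a ys))))
                          (𝔼₂-⊗ (square f) (square g))

coordSum-additive : (Φ : ∀ {m} → Stat m → ℚ) →
                    (∀ {a b} (f : Stat a) (g : Stat b) → Φ (f ⊕ g) ≡ Φ f + Φ g) →
                    Φ {0} (λ _ _ → 0ℚ) ≡ 0ℚ →
                    ∀ h k → Φ (coordSum h k) ≡ fromℕ k * Φ (atHead h)
coordSum-additive Φ Φ-⊕ Φ-0 h zero    = trans Φ-0 (sym (*-zeroˡ (Φ (atHead h))))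
coordSum-additive Φ Φ-⊕ Φ-0 h (suc k) = begin
  Φ (atHead h ⊕ coordSum h k)        ≡⟨ Φ-⊕ (atHead h) (coordSum h k) ⟩
  Φ (atHead h) + Φ (coordSum h k)    ≡⟨ cong (λ e → Φ (atHead h) + e) (coordSum-additive Φ Φ-⊕ Φ-0 h k) ⟩
  Φ (atHead h) + fromℕ k * Φ (atHead h) ≡⟨ solve 2 (λ φ n → φ :+ n :* φ := (con 1ℚ :+ n) :* φ) refl (Φ (atHead h)) (fromℕ k) ⟩
  (1ℚ + fromℕ k) * Φ (atHead h)      ≡⟨ cong (_* Φ (atHead h)) (fromℕ-suc k) ⟨
  fromℕ (suc k) * Φ (atHead h)       ∎
  where open ≡-Reasoning

bitDiff : Bool → Bool → ℚ
bitDiff true  false = 1ℚ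
bitDiff false true  = - 1ℚ
bitDiff _     _     = 0ℚ

mismatch : Bool → Bool → ℚ
mismatch a b = bitDiff a b * bitDiff a b

mismatch-idem : ∀ a b → mismatch a b * mismatch a b ≡ mismatch a b
mismatch-idem false false = refl
mismatch-idem false true  = refl
mismatch-idem true  false = refl
mismatch-idem true  true  = refl

mismatchRate : ℚ → ℚ → ℚ
mismatchRate p q = p * (1ℚ - q) + q * (1ℚ - p)

module _ (p q : ℚ) where
  open Moments p q

  𝔼₂-bitDiff : 𝔼₂ (atHead bitDiff) ≡ p - q
  𝔼₂-bitDiff = trans (𝔼₂-atHead bitDiff)
    (solve 2 (λ p q → (con 1ℚ :- p) :* ((con 1ℚ :- q) :* con 0ℚ :+ q :* con (- 1ℚ))
                      :+ p :* ((con 1ℚ :- q) :* con 1ℚ :+ q :* con 0ℚ) := p :- q) refl p q)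

  𝔼₂-mismatch : 𝔼₂ (atHead mismatch) ≡ mismatchRate p q
  𝔼₂-mismatch = trans (𝔼₂-atHead mismatch)
    (solve 2 (λ p q → (con 1ℚ :- p) :* ((con 1ℚ :- q) :* con 0ℚ :+ q :* con 1ℚ)
                      :+ p :* ((con 1ℚ :- q) :* con 1ℚ :+ q :* con 0ℚ)
                      := p :* (con 1ℚ :- q) :+ q :* (con 1ℚ :- p)) refl p q)

  Var-bitDiff : Var (atHead bitDiff) ≡ mismatchRate p q - (p - q) * (p - q)
  Var-bitDiff = trans (Var-moments (atHead bitDiff)) (cong₂ (λ s μ → s - μ * μ) 𝔼₂-mismatch 𝔼₂-bitDiff)

  Var-mismatch : Var (atHead mismatch) ≡ mismatchRate p q - mismatchRate p q * mismatchRate p q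
  Var-mismatch = trans (Var-moments (atHead mismatch)) (cong₂ (λ s μ → s - μ * μ)
    (trans (𝔼₂-cong {1} (λ xs ys → mismatch-idem (head xs) (head ys))) 𝔼₂-mismatch) 𝔼₂-mismatch)

accept : ℚ → ℚ
accept x with x ≤? 0ℚ
... | yes _ = 1ℚ
... | no  _ = 0ℚ

accept-unit : ∀ x → InUnit (accept x)
accept-unit x with x ≤? 0ℚ
... | yes _ = ≤ᵇ⇒≤ {0ℚ} {1ℚ} _ , ≤-refl
... | no  _ = ≤-refl , ≤ᵇ⇒≤ {0ℚ} {1ℚ} _

accept-deviation-pos : ∀ {μ} x → 0ℚ < μ → μ * μ * accept x ≤ (x - μ) * (x - μ)
accept-deviation-pos {μ} x 0<μ with x ≤? 0ℚ
... | no  _   = subst (_≤ (x - μ) * (x - μ)) (sym (*-zeroʳ (μ * μ))) (square-nonNeg (x - μ))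
... | yes x≤0 = subst₂ _≤_ (sym (*-identityʳ (μ * μ))) (solve 2 (λ μ x → (μ :- x) :* (μ :- x) := (x :- μ) :* (x :- μ)) refl μ x)
                  (square-mono-≤ (<⇒≤ 0<μ) μ≤μ-x)
  where
  μ≤μ-x : μ ≤ μ - x
  μ≤μ-x = ≤-by-nonNeg-gap (- x) (neg-antimono-≤ x≤0) refl

accept-deviation-neg : ∀ {μ} x → μ < 0ℚ → - (μ * μ) * accept x + μ * μ ≤ (x - μ) * (x - μ)
accept-deviation-neg {μ} x μ<0 with x ≤? 0ℚ
... | yes _   = subst (_≤ (x - μ) * (x - μ)) (solve 1 (λ μ → con 0ℚ := :- (μ :* μ) :* con 1ℚ :+ μ :* μ) refl μ)
                  (square-nonNeg (x - μ))
... | no  x≰0 = subst₂ _≤_ (solve 1 (λ μ → (:- μ) :* (:- μ) := :- (μ :* μ) :* con 0ℚ :+ μ :* μ) refl μ) refl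
                  (square-mono-≤ (<⇒≤ (neg-antimono-< μ<0)) -μ≤x-μ)
  where
  -μ≤x-μ : - μ ≤ x - μ
  -μ≤x-μ = ≤-by-nonNeg-gap x (<⇒≤ (≰⇒> x≰0)) (+-comm x (- μ))

≤⅓ : ∀ {s P V} → 0ℚ < s → s * P ≤ V → + 3 / 1 * V ≤ s → P ≤ oneThird
≤⅓ {s} {P} {V} 0<s sP≤V 3V≤s = *-cancelˡ-≤-pos s {{positive 0<s}} (begin
  s * P                       ≤⟨ sP≤V ⟩
  V                           ≡⟨ solve 1 (λ V → V := con oneThird :* (con (+ 3 / 1) :* V)) refl V ⟩
  oneThird * (+ 3 / 1 * V)    ≤⟨ *-monoˡ-≤-≥0 (≤ᵇ⇒≤ {0ℚ} {oneThird} _) 3V≤s ⟩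
  oneThird * s                ≡⟨ *-comm oneThird s ⟩
  s * oneThird                ∎)
  where open ≤-Reasoning

⅔≤ : ∀ {s P V} → 0ℚ < s → - s * P + s ≤ V → + 3 / 1 * V ≤ s → twoThirds ≤ P
⅔≤ {s} {P} {V} 0<s h 3V≤s =
  ≤-by-nonNeg-gap (oneThird - (1ℚ - P)) (p≤q⇒0≤q-p 1-P≤⅓)
    (solve 1 (λ P → P := con twoThirds :+ (con oneThird :- (con 1ℚ :- P))) refl P)
  where
  1-P≤⅓ : 1ℚ - P ≤ oneThird
  1-P≤⅓ = ≤⅓ 0<s (subst (_≤ V) (solve 2 (λ s P → :- s :* P :+ s := s :* (con 1ℚ :- P)) refl s P) h) 3V≤s

module _ {p q : ℚ} (p∈[0,1] : InUnit p) (q∈[0,1] : InUnit q) {m} (f : Stat m) where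
  open Moments p q

  𝔼₂-accept≤⅓ : 0ℚ < 𝔼₂ f → + 3 / 1 * Var f ≤ 𝔼₂ f * 𝔼₂ f → 𝔼₂ (λ xs ys → accept (f xs ys)) ≤ oneThird
  𝔼₂-accept≤⅓ 0<μ 3V≤μ² = ≤⅓ (*-pos 0<μ 0<μ) (begin
    𝔼₂ f * 𝔼₂ f * 𝔼₂ (λ xs ys → accept (f xs ys))   ≡⟨ 𝔼₂-*ˡ (𝔼₂ f * 𝔼₂ f) (λ xs ys → accept (f xs ys)) ⟨
    𝔼₂ (λ xs ys → 𝔼₂ f * 𝔼₂ f * accept (f xs ys))   ≤⟨ 𝔼₂-mono p∈[0,1] q∈[0,1] (λ xs ys → accept-deviation-pos (f xs ys) 0<μ) ⟩
    Var f                                           ∎) 3V≤μ²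
    where open ≤-Reasoning

  ⅔≤𝔼₂-accept : 𝔼₂ f < 0ℚ → + 3 / 1 * Var f ≤ 𝔼₂ f * 𝔼₂ f → twoThirds ≤ 𝔼₂ (λ xs ys → accept (f xs ys))
  ⅔≤𝔼₂-accept μ<0 3V≤μ² = ⅔≤ μ²-pos (begin
    - (𝔼₂ f * 𝔼₂ f) * 𝔼₂ (λ xs ys → accept (f xs ys)) + 𝔼₂ f * 𝔼₂ f
      ≡⟨ 𝔼₂-affine (- (𝔼₂ f * 𝔼₂ f)) (𝔼₂ f * 𝔼₂ f) (λ xs ys → accept (f xs ys)) ⟨
    𝔼₂ (λ xs ys → - (𝔼₂ f * 𝔼₂ f) * accept (f xs ys) + 𝔼₂ f * 𝔼₂ f)
      ≤⟨ 𝔼₂-mono p∈[0,1] q∈[0,1] (λ xs ys → accept-deviation-neg (f xs ys) μ<0) ⟩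
    Var f ∎) 3V≤μ²
    where
    open ≤-Reasoning
    μ²-pos : 0ℚ < 𝔼₂ f * 𝔼₂ f
    μ²-pos = subst (0ℚ <_) (solve 1 (λ μ → (:- μ) :* (:- μ) := μ :* μ) refl (𝔼₂ f))
                   (*-pos (neg-antimono-< μ<0) (neg-antimono-< μ<0))

accProb-𝔼₂ : ∀ {m} (A : Tester m) p q → accProb A p q ≡ Moments.𝔼₂ p q A
accProb-𝔼₂ {m} A p q = go (allVecs m)
  where
  go : ∀ xss → sumℚ (concatMap (λ xs → map (λ ys → seqProb p xs * seqProb q ys * A xs ys) (allVecs m)) xss)
               ≡ sumℚ (map (λ xs → seqProb p xs * 𝔼 q m (A xs)) xss)
  go []         = refl
  go (xs ∷ xss) = trans (sumℚ-++ (map (λ ys → seqProb p xs * seqProb q ys * A xs ys) (allVecs m)) _)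
    (cong₂ _+_ (trans (sumℚ-map-cong (allVecs m) (λ ys → *-assoc (seqProb p xs) (seqProb q ys) (A xs ys)))
                      (sumℚ-map-*ˡ (seqProb p xs) _ (allVecs m)))
               (go xss))

≤∧≢⇒< : ∀ {p q} → p ≤ q → p ≢ q → p < q
≤∧≢⇒< {p} {q} p≤q p≢q with <-cmp p q
... | tri< p<q _ _ = p<q
... | tri≈ _ p≡q _ = ⊥-elim (p≢q p≡q)
... | tri> _ _ q<p = ⊥-elim (<-irrefl refl (<-≤-trans q<p p≤q))

<÷⇒*< : ∀ {ε x d} .{{_ : ℚ.NonZero d}} → 0ℚ < d → ε < x ÷ d → ε * d < x
<÷⇒*< {ε} {x} {d} 0<d ε<x÷d = begin-strict
  ε * d          <⟨ *-monoˡ-<-pos d {{positive 0<d}} ε<x÷d ⟩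
  x * 1/ d * d   ≡⟨ *-assoc x (1/ d) d ⟩
  x * (1/ d * d) ≡⟨ cong (x *_) (*-inverseˡ d) ⟩
  x * 1ℚ         ≡⟨ *-identityʳ x ⟩
  x              ∎
  where open ≤-Reasoning

chi2-denominator : ∀ p q → (p + q) * ((1ℚ + 1ℚ) - (p + q)) ≡ (1ℚ + 1ℚ) * mismatchRate p q - (p - q) * (p - q)
chi2-denominator = solve 2 (λ p q → (p :+ q) :* ((con 1ℚ :+ con 1ℚ) :- (p :+ q))
                                    := (con 1ℚ :+ con 1ℚ) :* (p :* (con 1ℚ :- q) :+ q :* (con 1ℚ :- p)) :- (p :- q) :* (p :- q)) refl

module _ {p q : ℚ} (p∈[0,1] : InUnit p) (q∈[0,1] : InUnit q) where
  private
    0≤p   = proj₁ p∈[0,1]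
    0≤q   = proj₁ q∈[0,1]
    0≤1-p = p≤q⇒0≤q-p (proj₂ p∈[0,1])
    0≤1-q = p≤q⇒0≤q-p (proj₂ q∈[0,1])
    r     = mismatchRate p q

  mismatchRate-nonNeg : 0ℚ ≤ mismatchRate p q
  mismatchRate-nonNeg = +-mono-≤ (*-nonNeg 0≤p 0≤1-q) (*-nonNeg 0≤q 0≤1-p)

  mismatchRate-≤1 : mismatchRate p q ≤ 1ℚ
  mismatchRate-≤1 = ≤-by-nonNeg-gap ((1ℚ - p) * (1ℚ - q) + p * q) (+-mono-≤ (*-nonNeg 0≤1-p 0≤1-q) (*-nonNeg 0≤p 0≤q))
    (solve 2 (λ p q → con 1ℚ := p :* (con 1ℚ :- q) :+ q :* (con 1ℚ :- p) :+ ((con 1ℚ :- p) :* (con 1ℚ :- q) :+ p :* q)) refl p q)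

  mismatchRate²≤mismatchRate : r * r ≤ r
  mismatchRate²≤mismatchRate = subst (r * r ≤_) (*-identityʳ r) (*-monoˡ-≤-≥0 mismatchRate-nonNeg mismatchRate-≤1)

  -- r² - (p - q)² = (r - (p - q)) (r + (p - q)) = 2q(1 - p) · 2p(1 - q)
  diff²≤mismatchRate² : (p - q) * (p - q) ≤ r * r
  diff²≤mismatchRate² = ≤-by-nonNeg-gap (((1ℚ + 1ℚ) * (q * (1ℚ - p))) * ((1ℚ + 1ℚ) * (p * (1ℚ - q))))
    (*-nonNeg (*-nonNeg two≥0 (*-nonNeg 0≤q 0≤1-p)) (*-nonNeg two≥0 (*-nonNeg 0≤p 0≤1-q)))
    (solve 2 (λ p q → (p :* (con 1ℚ :- q) :+ q :* (con 1ℚ :- p)) :* (p :* (con 1ℚ :- q) :+ q :* (con 1ℚ :- p))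
                      := (p :- q) :* (p :- q) :+ ((con 1ℚ :+ con 1ℚ) :* (q :* (con 1ℚ :- p))) :* ((con 1ℚ :+ con 1ℚ) :* (p :* (con 1ℚ :- q))))
           refl p q)
    where two≥0 = ≤ᵇ⇒≤ {0ℚ} {1ℚ + 1ℚ} _

  diff²≤mismatchRate : (p - q) * (p - q) ≤ r
  diff²≤mismatchRate = ≤-trans diff²≤mismatchRate² mismatchRate²≤mismatchRate

  chi2-lower-bound : ∀ {ε} → 0ℚ < ε → ε < chi2 p q →
                     ε * ((1ℚ + 1ℚ) * r - (p - q) * (p - q)) < (p - q) * (p - q)
  chi2-lower-bound {ε} 0<ε ε<χ² with (p + q) * ((1ℚ + 1ℚ) - (p + q)) ≟ 0ℚ
  ... | yes _    = ⊥-elim (<-asym 0<ε ε<χ²)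
  ... | no  D≢0 = subst (λ D → ε * D < (p - q) * (p - q)) (chi2-denominator p q)
                        (<÷⇒*< {{≢-nonZero D≢0}} (≤∧≢⇒< 0≤D (λ 0≡D → D≢0 (sym 0≡D))) ε<χ²)
    where
    0≤D : 0ℚ ≤ (p + q) * ((1ℚ + 1ℚ) - (p + q))
    0≤D = *-nonNeg (+-mono-≤ 0≤p 0≤q)
            (subst (0ℚ ≤_) (solve 2 (λ p q → (con 1ℚ :- p) :+ (con 1ℚ :- q) := (con 1ℚ :+ con 1ℚ) :- (p :+ q)) refl p q)
                   (+-mono-≤ 0≤1-p 0≤1-q))

  ε<chi2⇒ε<1 : ∀ {ε} → 0ℚ < ε → ε < chi2 p q → ε < 1ℚ
  ε<chi2⇒ε<1 {ε} 0<ε ε<χ² = *-cancelʳ-<-nonNeg D {{nonNegative (≤-trans (square-nonNeg (p - q)) d²≤D)}} (begin-strict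
    ε * D            <⟨ chi2-lower-bound 0<ε ε<χ² ⟩
    (p - q) * (p - q) ≤⟨ d²≤D ⟩
    D                ≡⟨ *-identityˡ D ⟨
    1ℚ * D           ∎)
    where
    open ≤-Reasoning
    D = (1ℚ + 1ℚ) * r - (p - q) * (p - q)
    d²≤D : (p - q) * (p - q) ≤ D
    d²≤D = ≤-by-nonNeg-gap ((1ℚ + 1ℚ) * (r - (p - q) * (p - q)))
             (*-nonNeg (≤ᵇ⇒≤ {0ℚ} {1ℚ + 1ℚ} _) (p≤q⇒0≤q-p diff²≤mismatchRate))
             (solve 2 (λ r δ → (con 1ℚ :+ con 1ℚ) :* r :- δ := δ :+ (con 1ℚ :+ con 1ℚ) :* (r :- δ)) refl r ((p - q) * (p - q)))

-- For x = nr and A = (nd)², meanR x A is the mean of the statistic R of BlockTest n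
-- and varBound x A bounds its variance.
meanR : ℚ → ℚ → ℚ
meanR x A = A + (- (+ 3 / 1) * x + - (+ 5 / 1))

varBound : ℚ → ℚ → ℚ
varBound x A = (x + A) * (x + A) - A * A + + 9 / 1 * x

varBound-mono : ∀ {v w x A} → 0ℚ ≤ A → 0ℚ ≤ v → v ≤ x → w ≤ x →
                (v + A) * (v + A) - A * A + + 9 / 1 * w ≤ varBound x A
varBound-mono {A = A} 0≤A 0≤v v≤x w≤x =
  +-mono-≤ (+-monoˡ-≤ (- (A * A)) (square-mono-≤ (+-mono-≤ 0≤v 0≤A) (+-monoˡ-≤ A v≤x)))
           (*-monoˡ-≤-≥0 (≤ᵇ⇒≤ {0ℚ} {+ 9 / 1} _) w≤x)

null-margin : ∀ {x} → 0ℚ ≤ x → meanR x 0ℚ < 0ℚ × + 3 / 1 * varBound x 0ℚ ≤ meanR x 0ℚ * meanR x 0ℚ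
null-margin {x} 0≤x = μ<0 , 3B≤μ²
  where
  μ<0 : meanR x 0ℚ < 0ℚ
  μ<0 = subst (_< 0ℚ) (solve 1 (λ x → :- (con (+ 3 / 1) :* x :+ con (+ 5 / 1))
                                       := con 0ℚ :+ (:- con (+ 3 / 1) :* x :+ :- con (+ 5 / 1))) refl x)
          (neg-antimono-< (<-≤-trans (positive⁻¹ (+ 5 / 1))
                                     (≤-by-nonNeg-gap (+ 3 / 1 * x) (*-monoˡ-≤-≥0 (≤ᵇ⇒≤ {0ℚ} {+ 3 / 1} _) 0≤x)
                                                      (+-comm (+ 3 / 1 * x) (+ 5 / 1)))))
  3B≤μ² : + 3 / 1 * varBound x 0ℚ ≤ meanR x 0ℚ * meanR x 0ℚ
  3B≤μ² = ≤-by-nonNeg-gap (+ 6 / 1 * (x * x) + + 3 / 1 * x + + 25 / 1)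
    (+-mono-≤ (+-mono-≤ (*-nonNeg (≤ᵇ⇒≤ {0ℚ} {+ 6 / 1} _) (square-nonNeg x)) (*-nonNeg (≤ᵇ⇒≤ {0ℚ} {+ 3 / 1} _) 0≤x))
              (≤ᵇ⇒≤ {0ℚ} {+ 25 / 1} _))
    (solve 1 (λ x → let μ = con 0ℚ :+ (:- con (+ 3 / 1) :* x :+ :- con (+ 5 / 1)) in
                    μ :* μ := con (+ 3 / 1) :* ((x :+ con 0ℚ) :* (x :+ con 0ℚ) :- con 0ℚ :* con 0ℚ :+ con (+ 9 / 1) :* x)
                              :+ (con (+ 6 / 1) :* (x :* x) :+ con (+ 3 / 1) :* x :+ con (+ 25 / 1))) refl x)

far-margin : ∀ {x A} → + 16 / 1 ≤ x → + 16 / 1 * x ≤ A →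
             0ℚ < meanR x A × + 3 / 1 * varBound x A ≤ meanR x A * meanR x A
far-margin {x} {A} 16≤x 16x≤A =
  <-≤-trans 0<A-4x A-4x≤μ , ≤-trans 3B≤[A-4x]² (square-mono-≤ (<⇒≤ 0<A-4x) A-4x≤μ)
  where
  0≤x   = ≤-trans (fromℕ-nonNeg 16) 16≤x
  0≤A   = ≤-trans (*-nonNeg (fromℕ-nonNeg 16) 0≤x) 16x≤A
  0≤x-16   = p≤q⇒0≤q-p 16≤x
  0≤A-16x = p≤q⇒0≤q-p 16x≤A
  0<A-4x : 0ℚ < A - + 4 / 1 * x
  0<A-4x = <-≤-trans (positive⁻¹ (+ 192 / 1))
    (≤-by-nonNeg-gap ((A - + 16 / 1 * x) + + 12 / 1 * (x - + 16 / 1))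
       (+-mono-≤ 0≤A-16x (*-nonNeg (fromℕ-nonNeg 12) 0≤x-16))
       (solve 2 (λ x A → A :- con (+ 4 / 1) :* x
                         := con (+ 192 / 1) :+ ((A :- con (+ 16 / 1) :* x) :+ con (+ 12 / 1) :* (x :- con (+ 16 / 1))))
              refl x A))
  A-4x≤μ : A - + 4 / 1 * x ≤ meanR x A
  A-4x≤μ = ≤-by-nonNeg-gap ((x - + 16 / 1) + + 11 / 1) (+-mono-≤ 0≤x-16 (fromℕ-nonNeg 11))
    (solve 2 (λ x A → A :+ (:- con (+ 3 / 1) :* x :+ :- con (+ 5 / 1))
                      := (A :- con (+ 4 / 1) :* x) :+ ((x :- con (+ 16 / 1)) :+ con (+ 11 / 1))) refl x A)
  -- (A - 4x)² - 3 varBound x A = A (A - 14x) + x (13x - 27)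
  3B≤[A-4x]² : + 3 / 1 * varBound x A ≤ (A - + 4 / 1 * x) * (A - + 4 / 1 * x)
  3B≤[A-4x]² = ≤-by-nonNeg-gap (A * ((A - + 16 / 1 * x) + + 2 / 1 * x) + x * (+ 13 / 1 * (x - + 16 / 1) + + 181 / 1))
    (+-mono-≤ (*-nonNeg 0≤A (+-mono-≤ 0≤A-16x (*-nonNeg (fromℕ-nonNeg 2) 0≤x)))
              (*-nonNeg 0≤x (+-mono-≤ (*-nonNeg (fromℕ-nonNeg 13) 0≤x-16) (fromℕ-nonNeg 181))))
    (solve 2 (λ x A → (A :- con (+ 4 / 1) :* x) :* (A :- con (+ 4 / 1) :* x)
                      := con (+ 3 / 1) :* ((x :+ A) :* (x :+ A) :- A :* A :+ con (+ 9 / 1) :* x)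
                         :+ (A :* ((A :- con (+ 16 / 1) :* x) :+ con (+ 2 / 1) :* x)
                             :+ x :* (con (+ 13 / 1) :* (x :- con (+ 16 / 1)) :+ con (+ 181 / 1)))) refl x A)

far-parameters : ∀ {K ε r d κ} → 0ℚ < ε → 0ℚ ≤ K → 0ℚ ≤ r → d * d ≤ r * r → r * r ≤ r →
                 ε * ((1ℚ + 1ℚ) * r - d * d) < d * d → κ ≤ K * ε →
                 κ ≤ K * r × κ * (K * r) ≤ (K * d) * (K * d)
far-parameters {K} {ε} {r} {d} {κ} 0<ε 0≤K 0≤r d²≤r² r²≤r χ²-gap κ≤Kε = κ≤Kr , κKr≤A
  where
  open ≤-Reasoning
  d²≤r = ≤-trans d²≤r² r²≤r
  εr<d² : ε * r < d * d
  εr<d² = ≤-<-trans (≤-by-nonNeg-gap (ε * (r - d * d)) (*-nonNeg (<⇒≤ 0<ε) (p≤q⇒0≤q-p d²≤r))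
                       (solve 3 (λ ε r δ → ε :* ((con 1ℚ :+ con 1ℚ) :* r :- δ) := ε :* r :+ ε :* (r :- δ)) refl ε r (d * d)))
                    χ²-gap
  ε<r : ε < r
  ε<r = *-cancelʳ-<-nonNeg r {{nonNegative 0≤r}} (<-≤-trans εr<d² d²≤r²)
  κ≤Kr : κ ≤ K * r
  κ≤Kr = ≤-trans κ≤Kε (*-monoˡ-≤-≥0 0≤K (<⇒≤ ε<r))
  κKr≤A : κ * (K * r) ≤ (K * d) * (K * d)
  κKr≤A = begin
    κ * (K * r)          ≤⟨ *-monoʳ-≤-nonNeg (K * r) {{nonNegative (*-nonNeg 0≤K 0≤r)}} κ≤Kε ⟩
    K * ε * (K * r)      ≡⟨ solve 3 (λ K ε r → K :* ε :* (K :* r) := K :* K :* (ε :* r)) refl K ε r ⟩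
    K * K * (ε * r)      ≤⟨ *-monoˡ-≤-≥0 (*-nonNeg 0≤K 0≤K) (<⇒≤ εr<d²) ⟩
    K * K * (d * d)      ≡⟨ solve 2 (λ K d → K :* K :* (d :* d) := (K :* d) :* (K :* d)) refl K d ⟩
    (K * d) * (K * d)    ∎

Distinguishes : ℚ → ∀ {m} → Tester m → Set
Distinguishes ε A = ∀ (p q : ℚ) → InUnit p → InUnit q →
                    (p ≡ q → twoThirds ≤ accProb A p q) × (ε < chi2 p q → accProb A p q ≤ oneThird)

TesterFor : ℚ → ℕ → Set
TesterFor ε C = ∃[ m ] ((+ m / 1) * ε ≤ + C / 1 × Σ (Tester m) (λ A → ValidTester A × Distinguishes ε A))

module BlockTest (n : ℕ) where

  T N : Stat n
  T = coordSum bitDiff n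
  N = coordSum mismatch n

  Y : Stat n
  Y xs ys = - (+ 3 / 1) * N xs ys + - (+ 5 / 1)

  R : Stat (n ℕ.+ n ℕ.+ n)
  R = T ⊗ T ⊕ Y

  test : Tester (n ℕ.+ n ℕ.+ n)
  test xs ys = accept (R xs ys)

  test-valid : ValidTester test
  test-valid xs ys = accept-unit (R xs ys)

  module _ (p q : ℚ) where
    open Moments p q

    private
      K = fromℕ n
      r = mismatchRate p q
      x = K * r
      A = (K * (p - q)) * (K * (p - q))

    𝔼₂-T : 𝔼₂ T ≡ K * (p - q)
    𝔼₂-T = trans (coordSum-additive 𝔼₂ 𝔼₂-⊕ (𝔼₂-const 0 0ℚ) bitDiff n) (cong (K *_) (𝔼₂-bitDiff p q))

    𝔼₂-N : 𝔼₂ N ≡ x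
    𝔼₂-N = trans (coordSum-additive 𝔼₂ 𝔼₂-⊕ (𝔼₂-const 0 0ℚ) mismatch n) (cong (K *_) (𝔼₂-mismatch p q))

    Var-T : Var T ≡ K * (r - (p - q) * (p - q))
    Var-T = trans (coordSum-additive Var Var-⊕ (Var-const 0 0ℚ) bitDiff n) (cong (K *_) (Var-bitDiff p q))

    Var-N : Var N ≡ K * (r - r * r)
    Var-N = trans (coordSum-additive Var Var-⊕ (Var-const 0 0ℚ) mismatch n) (cong (K *_) (Var-mismatch p q))

    𝔼₂-R : 𝔼₂ R ≡ meanR x A
    𝔼₂-R = begin
      𝔼₂ (T ⊗ T ⊕ Y)                              ≡⟨ 𝔼₂-⊕ (T ⊗ T) Y ⟩
      𝔼₂ (T ⊗ T) + 𝔼₂ Y                           ≡⟨ cong₂ _+_ (𝔼₂-⊗ T T) (𝔼₂-affine (- (+ 3 / 1)) (- (+ 5 / 1)) N) ⟩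
      𝔼₂ T * 𝔼₂ T + (- (+ 3 / 1) * 𝔼₂ N + - (+ 5 / 1)) ≡⟨ cong₂ (λ μT μN → μT * μT + (- (+ 3 / 1) * μN + - (+ 5 / 1))) 𝔼₂-T 𝔼₂-N ⟩
      meanR x A                                   ∎
      where open ≡-Reasoning

    Var-R : Var R ≡ (K * (r - (p - q) * (p - q)) + A) * (K * (r - (p - q) * (p - q)) + A) - A * A
                    + - (+ 3 / 1) * - (+ 3 / 1) * (K * (r - r * r))
    Var-R = begin
      Var (T ⊗ T ⊕ Y)                ≡⟨ Var-⊕ (T ⊗ T) Y ⟩
      Var (T ⊗ T) + Var Y            ≡⟨ cong₂ _+_ (Var-⊗ T T) (Var-affine (- (+ 3 / 1)) (- (+ 5 / 1)) N) ⟩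
      𝔼₂ (square T) * 𝔼₂ (square T) - (𝔼₂ T * 𝔼₂ T) * (𝔼₂ T * 𝔼₂ T) + - (+ 3 / 1) * - (+ 3 / 1) * Var N
                                     ≡⟨ cong (λ s → s * s - (𝔼₂ T * 𝔼₂ T) * (𝔼₂ T * 𝔼₂ T) + - (+ 3 / 1) * - (+ 3 / 1) * Var N)
                                             (𝔼₂-square T) ⟩
      (Var T + 𝔼₂ T * 𝔼₂ T) * (Var T + 𝔼₂ T * 𝔼₂ T) - (𝔼₂ T * 𝔼₂ T) * (𝔼₂ T * 𝔼₂ T) + - (+ 3 / 1) * - (+ 3 / 1) * Var N
                                     ≡⟨ cong (λ μ → (Var T + μ * μ) * (Var T + μ * μ) - (μ * μ) * (μ * μ)
                                                    + - (+ 3 / 1) * - (+ 3 / 1) * Var N) 𝔼₂-T ⟩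
      (Var T + A) * (Var T + A) - A * A + - (+ 3 / 1) * - (+ 3 / 1) * Var N
                                     ≡⟨ cong₂ (λ v w → (v + A) * (v + A) - A * A + - (+ 3 / 1) * - (+ 3 / 1) * w) Var-T Var-N ⟩
      _                              ∎
      where open ≡-Reasoning

    module _ (p∈[0,1] : InUnit p) (q∈[0,1] : InUnit q) where

      Var-R≤ : Var R ≤ varBound x A
      Var-R≤ = ≤-trans (≤-reflexive Var-R)
        (varBound-mono (square-nonNeg (K * (p - q))) (*-nonNeg 0≤K (p≤q⇒0≤q-p (diff²≤mismatchRate p∈[0,1] q∈[0,1])))
                       (*-monoˡ-≤-≥0 0≤K (p-q≤p (square-nonNeg (p - q))))
                       (*-monoˡ-≤-≥0 0≤K (p-q≤p (*-nonNeg (mismatchRate-nonNeg p∈[0,1] q∈[0,1]) (mismatchRate-nonNeg p∈[0,1] q∈[0,1])))))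
        where 0≤K = fromℕ-nonNeg n

      3Var-R≤ : ∀ {μ} → + 3 / 1 * varBound x A ≤ μ → + 3 / 1 * Var R ≤ μ
      3Var-R≤ 3B≤μ = ≤-trans (*-monoˡ-≤-≥0 (fromℕ-nonNeg 3) Var-R≤) 3B≤μ

      accepts-if : meanR x A < 0ℚ → + 3 / 1 * varBound x A ≤ meanR x A * meanR x A → twoThirds ≤ accProb test p q
      accepts-if μ<0 3B≤μ² = subst (twoThirds ≤_) (sym (accProb-𝔼₂ test p q))
        (⅔≤𝔼₂-accept p∈[0,1] q∈[0,1] R (subst (_< 0ℚ) (sym 𝔼₂-R) μ<0)
                      (3Var-R≤ (subst (λ μ → + 3 / 1 * varBound x A ≤ μ * μ) (sym 𝔼₂-R) 3B≤μ²)))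

      rejects-if : 0ℚ < meanR x A → + 3 / 1 * varBound x A ≤ meanR x A * meanR x A → accProb test p q ≤ oneThird
      rejects-if 0<μ 3B≤μ² = subst (_≤ oneThird) (sym (accProb-𝔼₂ test p q))
        (𝔼₂-accept≤⅓ p∈[0,1] q∈[0,1] R (subst (0ℚ <_) (sym 𝔼₂-R) 0<μ)
                      (3Var-R≤ (subst (λ μ → + 3 / 1 * varBound x A ≤ μ * μ) (sym 𝔼₂-R) 3B≤μ²)))

  accepts-equal : ∀ p → InUnit p → twoThirds ≤ accProb test p p
  accepts-equal p p∈[0,1] = uncurry (accepts-if p p p∈[0,1] p∈[0,1])
    (subst (λ A → meanR x A < 0ℚ × + 3 / 1 * varBound x A ≤ meanR x A * meanR x A) (sym A≡0)
           (null-margin (*-nonNeg (fromℕ-nonNeg n) (mismatchRate-nonNeg p∈[0,1] p∈[0,1]))))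
    where
    x = fromℕ n * mismatchRate p p
    A≡0 : (fromℕ n * (p - p)) * (fromℕ n * (p - p)) ≡ 0ℚ
    A≡0 = solve 2 (λ K p → (K :* (p :- p)) :* (K :* (p :- p)) := con 0ℚ) refl (fromℕ n) p

  rejects-far : ∀ {ε} p q → InUnit p → InUnit q → 0ℚ < ε → + 16 / 1 ≤ fromℕ n * ε → ε < chi2 p q →
                accProb test p q ≤ oneThird
  rejects-far p q p∈[0,1] q∈[0,1] 0<ε 16≤nε ε<χ² = uncurry (rejects-if p q p∈[0,1] q∈[0,1])
    (uncurry far-margin (far-parameters 0<ε (fromℕ-nonNeg n) (mismatchRate-nonNeg p∈[0,1] q∈[0,1])
                                        (diff²≤mismatchRate² p∈[0,1] q∈[0,1]) (mismatchRate²≤mismatchRate p∈[0,1] q∈[0,1])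
                                        (chi2-lower-bound p∈[0,1] q∈[0,1] 0<ε ε<χ²) 16≤nε))

  distinguishes : ∀ {ε} → 0ℚ < ε → + 16 / 1 ≤ fromℕ n * ε → Distinguishes ε test
  distinguishes 0<ε 16≤nε p q p∈[0,1] q∈[0,1] =
    (λ { refl → accepts-equal p p∈[0,1] }) , rejects-far p q p∈[0,1] q∈[0,1] 0<ε 16≤nε

  sample-bound : ∀ {ε} → ε ≤ 1ℚ → fromℕ n * ε ≤ + 16 / 1 + ε → fromℕ (n ℕ.+ n ℕ.+ n) * ε ≤ + 51 / 1
  sample-bound {ε} ε≤1 nε≤16+ε = begin
    fromℕ (n ℕ.+ n ℕ.+ n) * ε         ≡⟨ cong (_* ε) (trans (fromℕ-+ (n ℕ.+ n) n) (cong (_+ fromℕ n) (fromℕ-+ n n))) ⟩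
    (fromℕ n + fromℕ n + fromℕ n) * ε ≡⟨ solve 2 (λ n ε → (n :+ n :+ n) :* ε := con (+ 3 / 1) :* (n :* ε)) refl (fromℕ n) ε ⟩
    + 3 / 1 * (fromℕ n * ε)           ≤⟨ *-monoˡ-≤-≥0 (fromℕ-nonNeg 3) (≤-trans nε≤16+ε (+-monoʳ-≤ (+ 16 / 1) ε≤1)) ⟩
    + 3 / 1 * (+ 16 / 1 + 1ℚ)         ≡⟨⟩
    + 51 / 1                          ∎
    where open ≤-Reasoning

always-accept-tester : ∀ {ε} C → 0ℚ < ε → 1ℚ ≤ ε → TesterFor ε C
always-accept-tester {ε} C 0<ε 1≤ε =
  0 , ≤-trans (≤-reflexive (*-zeroˡ ε)) (fromℕ-nonNeg C) ,
  (λ _ _ → 1ℚ) , (λ _ _ → ≤ᵇ⇒≤ {0ℚ} {1ℚ} _ , ≤-refl) ,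
  λ p q p∈[0,1] q∈[0,1] →
    -- with no samples, accProb evaluates to the closed term 1ℚ
    (λ _ → ≤ᵇ⇒≤ {twoThirds} {1ℚ} _) ,
    (λ ε<χ² → ⊥-elim (<-irrefl refl (<-≤-trans (ε<chi2⇒ε<1 p∈[0,1] q∈[0,1] 0<ε ε<χ²) 1≤ε)))

block-tester : ∀ {ε} → 0ℚ < ε → ε ≤ 1ℚ → TesterFor ε 51
block-tester {ε} 0<ε ε≤1 =
  n ℕ.+ n ℕ.+ n , BlockTest.sample-bound n ε≤1 nε≤16+ε ,
  BlockTest.test n , BlockTest.test-valid n , BlockTest.distinguishes n 0<ε 16≤nε
  where
  window = ∃-multiple-between 15 0<ε
  n      = proj₁ window
  16≤nε  = proj₁ (proj₂ window)
  nε≤16+ε = proj₂ (proj₂ window)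

lemma22 : ∃[ C ] (∀ (ε : ℚ) → 0ℚ < ε →
    ∃[ m ] (((+ m / 1) * ε ≤ (+ C / 1)) ×
    Σ (Tester m) (λ A → ValidTester A ×
    (∀ (p q : ℚ) → InUnit p → InUnit q →
    (p ≡ q → twoThirds ≤ accProb A p q) ×
    (ε < chi2 p q → accProb A p q ≤ oneThird)))))
lemma22 = 51 , λ ε 0<ε → [ always-accept-tester 51 0<ε , block-tester 0<ε ]′ (≤-total 1ℚ ε)
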